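{- Let $p$ be a prime, let $w_1,w_2,w_3$ be positive integers, let $y_1,y_2\in\mathbb{Z}_p$, and let $n\ge0$ be an integer. Then the following six expressions are all equal: \begin{align*} &w_{1}^{n-1}\sum_{k=0}^{n}\binom{n}{k}B_{k}(w_{3}y_{1})\sum_{i=0}^{w_{1}-1}B_{n-k}\Big(w_{2}y_{2}+\frac{w_{2}}{w_{1}}i\Big)w_{3}^{n-k}w_{2}^{k}\\ &=w_{1}^{n-1}\sum_{k=0}^{n}\binom{n}{k}B_{k}(w_{2}y_{1})\sum_{i=0}^{w_{1}-1}B_{n-k}\Big(w_{3}y_{2}+\frac{w_{3}}{w_{1}}i\Big)w_{2}^{n-k}w_{3}^{k}\\ &=w_{2}^{n-1}\sum_{k=0}^{n}\binom{n}{k}B_{k}(w_{3}y_{1})\sum_{i=0}^{w_{2}-1}B_{n-k}\Big(w_{1}y_{2}+\frac{w_{1}}{w_{2}}i\Big)w_{3}^{n-k}w_{1}^{k}\\ &=w_{2}^{n-1}\sum_{k=0}^{n}\binom{n}{k}B_{k}(w_{1}y_{1})\sum_{i=0}^{w_{2}-1}B_{n-k}\Big(w_{3}y_{2}+\frac{w_{3}}{w_{2}}i\Big)w_{1}^{n-k}w_{3}^{k}\\ &=w_{3}^{n-1}\sum_{k=0}^{n}\binom{n}{k}B_{k}(w_{2}y_{1})\sum_{i=0}^{w_{3}-1}B_{n-k}\Big(w_{1}y_{2}+\frac{w_{1}}{w_{3}}i\Big)w_{2}^{n-k}w_{1}^{k}\\ &=w_{3}^{n-1}\sum_{k=0}^{n}\binom{n}{k}B_{k}(w_{1}y_{1})\sum_{i=0}^{w_{3}-1}B_{n-k}\Big(w_{2}y_{2}+\frac{w_{2}}{w_{3}}i\Big)w_{1}^{n-k}w_{2}^{k}.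 \end{align*}
   Context: $\mathbb{Z}_p$ denotes the ring of $p$-adic integers. The Bernoulli polynomials $B_n(x)$ are defined by $\frac{t}{e^t-1}e^{xt}=\sum_{n\ge0}B_n(x)\frac{t^n}{n!}$. -}

module Defs where

open import Level using (Level)
open import Data.Nat as ℕ using (ℕ; zero; suc; NonZero; _∸_)
open import Data.Nat.Combinatorics using (_C_)
open import Data.Integer as ℤ using (+_)
open import Data.List using (List; []; _∷_; zipWith; reverse; upTo; foldr)
open import Data.Rational as ℚ using (ℚ)
open import Data.Rational.Properties using (+-*-commutativeRing)
open import Algebra.Bundles using (CommutativeRing; RawRing)
open import Algebra.Morphism.Structures using (module RingMorphisms)

ℕ→ℚ : ℕ → ℚ
ℕ→ℚ n = (+ n) ℚ./ 1

-- Bernoulli numbers B_0, B_1 = -1/2, ... (the coefficients of t/(e^t-1)),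
-- via the recurrence  sum_{k=0}^{m} C(m+1,k) B_k = 0  for m ≥ 1
-- (equivalent to t = (e^t - 1) * sum B_k t^k/k!).
-- bernRev n = [B_n, B_{n-1}, ..., B_0]
bernRev : ℕ → List ℚ
bernRev zero = ℚ.1ℚ ∷ []
bernRev (suc n) = next ∷ prev
  where
  prev : List ℚ
  prev = bernRev n
  s : ℚ
  s = foldr ℚ._+_ ℚ.0ℚ
        (zipWith (λ k b → ℕ→ℚ (suc (suc n) C k) ℚ.* b) (upTo (suc n)) (reverse prev))
  next : ℚ
  next = ℚ.- (((+ 1) ℚ./ suc (suc n)) ℚ.* s)

bern : ℕ → ℚ
bern n with bernRev n
... | b ∷ _ = b
... | []    = ℚ.0ℚ

ℚRawRing : RawRing _ _
ℚRawRing = CommutativeRing.rawRing +-*-commutativeRing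

IsℚAlgebraMap : ∀ {c ℓ} (R : CommutativeRing c ℓ) → (ℚ → CommutativeRing.Carrier R) → Set _
IsℚAlgebraMap R φ = RingMorphisms.IsRingHomomorphism ℚRawRing (CommutativeRing.rawRing R) φ

module _ {c ℓ} (R : CommutativeRing c ℓ) (φ : ℚ → CommutativeRing.Carrier R) where
  open CommutativeRing R

  powR : Carrier → ℕ → Carrier
  powR x zero = 1#
  powR x (suc n) = x * powR x n

  sumR : ℕ → (ℕ → Carrier) → Carrier
  sumR zero f = 0#
  sumR (suc n) f = sumR n f + f n

  bernPoly : ℕ → Carrier → Carrier
  bernPoly m x = sumR (suc m) (λ k → φ (ℕ→ℚ (m C k) ℚ.* bern (m ∸ k)) * powR x k)

  -- a^(n-1) as a rational number (for n = 0 this is 1/a)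
  powPred : (a : ℕ) → .{{NonZero a}} → ℕ → ℚ
  powPred a zero = (+ 1) ℚ./ a
  powPred a (suc m) = ℕ→ℚ (a ℕ.^ m)

  bigE : (n a b c : ℕ) → .{{NonZero a}} → Carrier → Carrier → Carrier
  bigE n a b c y₁ y₂ =
    φ (powPred a n) *
    sumR (suc n) (λ k →
      φ (ℕ→ℚ (n C k)) * bernPoly k (φ (ℕ→ℚ c) * y₁) *
      sumR a (λ i → bernPoly (n ∸ k)
                      (φ (ℕ→ℚ b) * y₂ + φ (((+ b) ℚ./ a) ℚ.* ℕ→ℚ i))) *
      φ (ℕ→ℚ (c ℕ.^ (n ∸ k) ℕ.* b ℕ.^ k)))

{-# OPTIONS --safe #-}
-- Read a sequence (fₙ) as the exponential generating function Σ fₙ tⁿ/n!.  Then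
-- Σ Bₙ(x) tⁿ/n! = t eˣᵗ / (eᵗ − 1), and the sum over i telescopes:
-- (eᵘᵗ − 1) Σ_{i<a} eᵘⁱᵗ = eᵘᵃᵗ − 1.  Hence, with α, β, γ the weights in the roles of w₁, w₂, w₃
-- and m = αβγ, the generating function of the first expression is
--   m t² (eᵐᵗ − 1) e^{m(y₁+y₂)t} / ((e^{αβt} − 1)(e^{αγt} − 1)(e^{βγt} − 1)),
-- which is symmetric in α, β, γ.  The division is legitimate because over a ℚ-algebra
-- multiplication by eᵘᵗ − 1 is injective for every nonzero integer u.
module Submission where

open import Defs
open import Data.Nat as ℕ using (ℕ; zero; suc; NonZero; _∸_; _<_; s≤s)
import Data.Nat.Properties as ℕP
open import Data.Nat.Combinatorics using (_C_; nCn≡1; nC1≡n; nCk≡nC[n∸k]; nCk+nC[k+1]≡[n+1]C[k+1])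
open import Data.Nat.Combinatorics.Specification using (k>n⇒nCk≡0)
open import Data.Nat.Induction using (<-rec)
open import Data.Nat.Primality using (Prime)
open import Data.Integer as ℤ using (+_)
import Data.Integer.Properties as ℤP
open import Data.Integer.Tactic.RingSolver using (solve-∀)
open import Data.Rational as ℚ using (ℚ)
import Data.Rational.Properties as ℚP
open import Data.Rational.Unnormalised as ℚᵘ using (mkℚᵘ; *≡*) renaming (_≃_ to _≃ᵘ_)
import Data.Rational.Unnormalised.Properties as ℚᵘP
open import Data.List using (_∷_; zipWith; reverse; foldr; applyUpTo; applyDownFrom)
import Data.List.Properties as ListP
open import Data.Product using (_×_; _,_)
open import Function using (_∘_; id)
open import Relation.Binary.PropositionalEquality as ≡ using (_≡_; cong)
open import Algebra.Bundles using (CommutativeRing)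
open import Algebra.Morphism.Structures using (module RingMorphisms)
import Algebra.Construct.Pointwise as Pointwise
import Algebra.Properties.CommutativeSemigroup as CommutativeSemigroupProperties
import Algebra.Properties.Ring as RingProperties
import Algebra.Solver.CommutativeMonoid as CommutativeMonoidSolver
import Relation.Binary.Reasoning.Setoid as SetoidReasoning

module FiniteSums {c ℓ} (R : CommutativeRing c ℓ) (φ : ℚ → CommutativeRing.Carrier R) where
  open CommutativeRing R
  open SetoidReasoning setoid
  open CommutativeSemigroupProperties +-commutativeSemigroup using (interchange)

  ∑ : ℕ → (ℕ → Carrier) → Carrier
  ∑ = sumR R φ

  syntax ∑ n (λ i → x) = ∑[ i < n ] x

  sum-cong< : ∀ n {f g} → (∀ i → i < n → f i ≈ g i) → ∑ n f ≈ ∑ n g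
  sum-cong< zero    f≈g = refl
  sum-cong< (suc n) f≈g = +-cong (sum-cong< n (λ i i<n → f≈g i (ℕP.m<n⇒m<1+n i<n))) (f≈g n (ℕP.n<1+n n))

  sum-cong : ∀ n {f g} → (∀ i → f i ≈ g i) → ∑ n f ≈ ∑ n g
  sum-cong n f≈g = sum-cong< n (λ i _ → f≈g i)

  sum-zero : ∀ n {f} → (∀ i → i < n → f i ≈ 0#) → ∑ n f ≈ 0#
  sum-zero zero    f≈0 = refl
  sum-zero (suc n) f≈0 = begin
    ∑ n _ + _  ≈⟨ +-cong (sum-zero n (λ i i<n → f≈0 i (ℕP.m<n⇒m<1+n i<n))) (f≈0 n (ℕP.n<1+n n)) ⟩
    0# + 0#    ≈⟨ +-identityˡ 0# ⟩
    0#         ∎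

  sum-+ : ∀ n f g → ∑[ i < n ] (f i + g i) ≈ ∑ n f + ∑ n g
  sum-+ zero    f g = sym (+-identityˡ 0#)
  sum-+ (suc n) f g = trans (+-cong (sum-+ n f g) refl) (interchange _ _ _ _)

  sum-distribˡ : ∀ n x f → x * ∑ n f ≈ ∑[ i < n ] (x * f i)
  sum-distribˡ zero    x f = zeroʳ x
  sum-distribˡ (suc n) x f = trans (distribˡ x _ _) (+-cong (sum-distribˡ n x f) refl)

  sum-head : ∀ n f → ∑ (suc n) f ≈ f 0 + ∑ n (f ∘ suc)
  sum-head zero    f = trans (+-identityˡ _) (sym (+-identityʳ _))
  sum-head (suc n) f = trans (+-cong (sum-head n f) refl) (+-assoc _ _ _)

toℚᵘ-ℕ→ℚ : ∀ n → ℚ.toℚᵘ (ℕ→ℚ n) ≃ᵘ mkℚᵘ (+ n) 0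
toℚᵘ-ℕ→ℚ n = ℚP.toℚᵘ-fromℚᵘ (mkℚᵘ (+ n) 0)

ℕ→ℚ-+ : ∀ m n → ℕ→ℚ (m ℕ.+ n) ≡ ℕ→ℚ m ℚ.+ ℕ→ℚ n
ℕ→ℚ-+ m n = ℚP.toℚᵘ-injective (begin
  ℚ.toℚᵘ (ℕ→ℚ (m ℕ.+ n))                    ≈⟨ toℚᵘ-ℕ→ℚ (m ℕ.+ n) ⟩
  mkℚᵘ (+ (m ℕ.+ n)) 0                       ≈⟨ *≡* (≡.trans (cong (ℤ._* + 1) (ℤP.pos-+ m n)) (cross-multiplied (+ m) (+ n))) ⟩
  mkℚᵘ (+ m) 0 ℚᵘ.+ mkℚᵘ (+ n) 0             ≈⟨ ℚᵘP.+-cong (toℚᵘ-ℕ→ℚ m) (toℚᵘ-ℕ→ℚ n) ⟨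
  ℚ.toℚᵘ (ℕ→ℚ m) ℚᵘ.+ ℚ.toℚᵘ (ℕ→ℚ n)        ≈⟨ ℚP.toℚᵘ-homo-+ (ℕ→ℚ m) (ℕ→ℚ n) ⟨
  ℚ.toℚᵘ (ℕ→ℚ m ℚ.+ ℕ→ℚ n)                  ∎)
  where
  open SetoidReasoning ℚᵘP.≃-setoid
  cross-multiplied : ∀ x y → (x ℤ.+ y) ℤ.* + 1 ≡ (x ℤ.* + 1 ℤ.+ y ℤ.* + 1) ℤ.* + 1
  cross-multiplied = solve-∀

ℕ→ℚ-*-/ : ∀ a b .{{_ : NonZero a}} → ℕ→ℚ a ℚ.* (+ b ℚ./ a) ≡ ℕ→ℚ b
ℕ→ℚ-*-/ (suc a) b = ℚP.toℚᵘ-injective (begin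
  ℚ.toℚᵘ (ℕ→ℚ (suc a) ℚ.* (+ b ℚ./ suc a))               ≈⟨ ℚP.toℚᵘ-homo-* (ℕ→ℚ (suc a)) (+ b ℚ./ suc a) ⟩
  ℚ.toℚᵘ (ℕ→ℚ (suc a)) ℚᵘ.* ℚ.toℚᵘ (+ b ℚ./ suc a)     ≈⟨ ℚᵘP.*-cong (toℚᵘ-ℕ→ℚ (suc a)) (ℚP.toℚᵘ-fromℚᵘ (mkℚᵘ (+ b) a)) ⟩
  mkℚᵘ (+ suc a) 0 ℚᵘ.* mkℚᵘ (+ b) a                     ≈⟨ *≡* (≡.trans (cross-multiplied (+ suc a) (+ b)) (cong (λ d → + b ℤ.* + suc d) (≡.sym (ℕP.+-identityʳ a)))) ⟩
  mkℚᵘ (+ b) 0                                          ≈⟨ toℚᵘ-ℕ→ℚ b ⟨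
  ℚ.toℚᵘ (ℕ→ℚ b)                                        ∎)
  where
  open SetoidReasoning ℚᵘP.≃-setoid
  cross-multiplied : ∀ x y → (x ℤ.* y) ℤ.* + 1 ≡ y ℤ.* x
  cross-multiplied = solve-∀

bernRev≡applyDownFrom : ∀ n → bernRev n ≡ applyDownFrom bern (suc n)
bernRev≡applyDownFrom zero    = ≡.refl
bernRev≡applyDownFrom (suc n) = cong (bern (suc n) ∷_) (bernRev≡applyDownFrom n)

reverse-bernRev : ∀ n → reverse (bernRev n) ≡ applyUpTo bern (suc n)
reverse-bernRev n = begin
  reverse (bernRev n)                             ≡⟨ cong reverse (bernRev≡applyDownFrom n) ⟩
  reverse (applyDownFrom bern (suc n))            ≡⟨ cong reverse (ListP.reverse-applyUpTo bern (suc n)) ⟨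
  reverse (reverse (applyUpTo bern (suc n)))      ≡⟨ ListP.reverse-involutive _ ⟩
  applyUpTo bern (suc n)                          ∎
  where open ≡.≡-Reasoning

module ℚSums = FiniteSums ℚP.+-*-commutativeRing id

foldr-zipWith-applyUpTo : ∀ m (F : ℕ → ℚ → ℚ) (h : ℕ → ℕ) (g : ℕ → ℚ) →
  foldr ℚ._+_ ℚ.0ℚ (zipWith F (applyUpTo h m) (applyUpTo g m)) ≡ ℚSums.∑ m (λ k → F (h k) (g k))
foldr-zipWith-applyUpTo zero    F h g = ≡.refl
foldr-zipWith-applyUpTo (suc m) F h g =
  ≡.trans (cong (F (h 0) (g 0) ℚ.+_) (foldr-zipWith-applyUpTo m F (h ∘ suc) (g ∘ suc)))
          (≡.sym (ℚSums.sum-head m (λ k → F (h k) (g k))))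

-- bern (suc m) is defined so that its term C(m+2, m+1) B_{m+1} = (m+2) B_{m+1} cancels the others.
bern-recurrence : ∀ m → ℚSums.∑ (suc (suc m)) (λ k → ℕ→ℚ (suc (suc m) C k) ℚ.* bern k) ≡ ℚ.0ℚ
bern-recurrence m = begin
  s ℚ.+ ℕ→ℚ (N C suc m) ℚ.* bern (suc m)         ≡⟨ ≡.cong₂ (λ x y → x ℚ.+ ℕ→ℚ y ℚ.* bern (suc m)) s≡s₀ N-C-pred ⟩
  s₀ ℚ.+ ℕ→ℚ N ℚ.* ℚ.- ((+ 1 ℚ./ N) ℚ.* s₀)     ≡⟨ cong (s₀ ℚ.+_) (ℚP.neg-distribʳ-* (ℕ→ℚ N) _) ⟨
  s₀ ℚ.+ ℚ.- (ℕ→ℚ N ℚ.* ((+ 1 ℚ./ N) ℚ.* s₀))   ≡⟨ cong (λ x → s₀ ℚ.+ ℚ.- x) (ℚP.*-assoc (ℕ→ℚ N) _ s₀) ⟨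
  s₀ ℚ.+ ℚ.- ((ℕ→ℚ N ℚ.* (+ 1 ℚ./ N)) ℚ.* s₀)   ≡⟨ cong (λ x → s₀ ℚ.+ ℚ.- (x ℚ.* s₀)) (ℕ→ℚ-*-/ N 1) ⟩
  s₀ ℚ.+ ℚ.- (ℚ.1ℚ ℚ.* s₀)                      ≡⟨ cong (λ x → s₀ ℚ.+ ℚ.- x) (ℚP.*-identityˡ s₀) ⟩
  s₀ ℚ.+ ℚ.- s₀                                 ≡⟨ ℚP.+-inverseʳ s₀ ⟩
  ℚ.0ℚ                                          ∎
  where
  open ≡.≡-Reasoning
  N = suc (suc m)
  term : ℕ → ℚ → ℚ
  term k b = ℕ→ℚ (N C k) ℚ.* b
  s s₀ : ℚ
  s  = ℚSums.∑ (suc m) (λ k → term k (bern k))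
  s₀ = foldr ℚ._+_ ℚ.0ℚ (zipWith term (applyUpTo id (suc m)) (reverse (bernRev m)))
  s≡s₀ : s ≡ s₀
  s≡s₀ = ≡.sym (≡.trans (cong (λ bs → foldr ℚ._+_ ℚ.0ℚ (zipWith term (applyUpTo id (suc m)) bs)) (reverse-bernRev m))
                        (foldr-zipWith-applyUpTo (suc m) term id bern))
  N-C-pred : N C suc m ≡ N
  N-C-pred = ≡.trans (nCk≡nC[n∸k] (ℕP.n≤1+n (suc m))) (≡.trans (cong (N C_) (ℕP.m+n∸n≡m 1 (suc m))) (nC1≡n N))

module ExponentialSeries {c ℓ} (R : CommutativeRing c ℓ) where
  open CommutativeRing R
  open SetoidReasoning setoid
  open CommutativeSemigroupProperties +-commutativeSemigroup using (interchange)

  Series : Set c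
  Series = ℕ → Carrier

  infix  4 _≋_
  infixl 6 _⊕_
  infixl 7 _⊛_
  infixr 8 _·_
  infix  9 ⊝_

  _≋_ : Series → Series → Set ℓ
  f ≋ g = ∀ n → f n ≈ g n

  _⊕_ : Series → Series → Series
  (f ⊕ g) n = f n + g n

  ⊝_ : Series → Series
  (⊝ f) n = - f n

  _·_ : Carrier → Series → Series
  (x · f) n = x * f n

  𝟘 𝟙 X : Series
  𝟘 n = 0#
  𝟙 zero    = 1#
  𝟙 (suc n) = 0#
  X 1 = 1#
  X _ = 0#

  ∂ : Series → Series
  ∂ f n = f (suc n)

  -- The product of exponential generating functions, characterised by the Leibniz rule for ∂ = d/dt.
  _⊛_ : Series → Series → Series
  (f ⊛ g) zero    = f 0 * g 0
  (f ⊛ g) (suc n) = (∂ f ⊛ g) n + (f ⊛ ∂ g) n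

  const : Carrier → Series
  const x = x · 𝟙

  ≋-refl : ∀ {f} → f ≋ f
  ≋-refl _ = refl

  ⊛-cong : ∀ {f f′ g g′} → f ≋ f′ → g ≋ g′ → f ⊛ g ≋ f′ ⊛ g′
  ⊛-cong f≋f′ g≋g′ zero    = *-cong (f≋f′ 0) (g≋g′ 0)
  ⊛-cong f≋f′ g≋g′ (suc n) = +-cong (⊛-cong (f≋f′ ∘ suc) g≋g′ n) (⊛-cong f≋f′ (g≋g′ ∘ suc) n)

  ⊛-comm : ∀ f g → f ⊛ g ≋ g ⊛ f
  ⊛-comm f g zero    = *-comm (f 0) (g 0)
  ⊛-comm f g (suc n) = trans (+-cong (⊛-comm (∂ f) g n) (⊛-comm f (∂ g) n)) (+-comm _ _)

  ⊛-distribʳ : ∀ h f g → (f ⊕ g) ⊛ h ≋ f ⊛ h ⊕ g ⊛ h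
  ⊛-distribʳ h f g zero    = distribʳ (h 0) (f 0) (g 0)
  ⊛-distribʳ h f g (suc n) =
    trans (+-cong (⊛-distribʳ h (∂ f) (∂ g) n) (⊛-distribʳ (∂ h) f g n)) (interchange _ _ _ _)

  ⊛-distribˡ : ∀ f g h → f ⊛ (g ⊕ h) ≋ f ⊛ g ⊕ f ⊛ h
  ⊛-distribˡ f g h n = begin
    (f ⊛ (g ⊕ h)) n            ≈⟨ ⊛-comm f (g ⊕ h) n ⟩
    ((g ⊕ h) ⊛ f) n            ≈⟨ ⊛-distribʳ f g h n ⟩
    (g ⊛ f) n + (h ⊛ f) n      ≈⟨ +-cong (⊛-comm g f n) (⊛-comm h f n) ⟩
    (f ⊛ g) n + (f ⊛ h) n      ∎

  ·-⊛ : ∀ x f g → x · f ⊛ g ≋ x · (f ⊛ g)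
  ·-⊛ x f g zero    = *-assoc x (f 0) (g 0)
  ·-⊛ x f g (suc n) = trans (+-cong (·-⊛ x (∂ f) g n) (·-⊛ x f (∂ g) n)) (sym (distribˡ x _ _))

  ⊛-· : ∀ x f g → f ⊛ x · g ≋ x · (f ⊛ g)
  ⊛-· x f g n = trans (⊛-comm f (x · g) n) (trans (·-⊛ x g f n) (*-cong refl (⊛-comm g f n)))

  ⊛-zeroˡ : ∀ f → 𝟘 ⊛ f ≋ 𝟘
  ⊛-zeroˡ f zero    = zeroˡ (f 0)
  ⊛-zeroˡ f (suc n) = trans (+-cong (⊛-zeroˡ f n) (⊛-zeroˡ (∂ f) n)) (+-identityˡ 0#)

  ⊛-identityˡ : ∀ f → 𝟙 ⊛ f ≋ f
  ⊛-identityˡ f zero    = *-identityˡ (f 0)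
  ⊛-identityˡ f (suc n) = trans (+-cong (⊛-zeroˡ f n) (⊛-identityˡ (∂ f) n)) (+-identityˡ _)

  ⊛-assoc : ∀ f g h → (f ⊛ g) ⊛ h ≋ f ⊛ (g ⊛ h)
  ⊛-assoc f g h zero    = *-assoc (f 0) (g 0) (h 0)
  ⊛-assoc f g h (suc n) = begin
    ((∂ f ⊛ g ⊕ f ⊛ ∂ g) ⊛ h) n + ((f ⊛ g) ⊛ ∂ h) n
      ≈⟨ +-cong (⊛-distribʳ h (∂ f ⊛ g) (f ⊛ ∂ g) n) (⊛-assoc f g (∂ h) n) ⟩
    (((∂ f ⊛ g) ⊛ h) n + ((f ⊛ ∂ g) ⊛ h) n) + (f ⊛ (g ⊛ ∂ h)) n
      ≈⟨ +-cong (+-cong (⊛-assoc (∂ f) g h n) (⊛-assoc f (∂ g) h n)) refl ⟩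
    ((∂ f ⊛ (g ⊛ h)) n + (f ⊛ (∂ g ⊛ h)) n) + (f ⊛ (g ⊛ ∂ h)) n
      ≈⟨ +-assoc _ _ _ ⟩
    (∂ f ⊛ (g ⊛ h)) n + ((f ⊛ (∂ g ⊛ h)) n + (f ⊛ (g ⊛ ∂ h)) n)
      ≈⟨ +-cong refl (⊛-distribˡ f (∂ g ⊛ h) (g ⊛ ∂ h) n) ⟨
    (∂ f ⊛ (g ⊛ h)) n + (f ⊛ (∂ g ⊛ h ⊕ g ⊛ ∂ h)) n
      ∎

  seriesRing : CommutativeRing c ℓ
  seriesRing = record
    { Carrier = Series ; _≈_ = _≋_ ; _+_ = _⊕_ ; _*_ = _⊛_ ; -_ = ⊝_ ; 0# = 𝟘 ; 1# = 𝟙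
    ; isCommutativeRing = record
      { isRing = record
        { +-isAbelianGroup = Pointwise.isAbelianGroup ℕ +-isAbelianGroup
        ; *-cong = ⊛-cong
        ; *-assoc = ⊛-assoc
        ; *-identity = ⊛-identityˡ , λ f n → trans (⊛-comm f 𝟙 n) (⊛-identityˡ f n)
        ; distrib = ⊛-distribˡ , ⊛-distribʳ
        }
      ; *-comm = ⊛-comm
      }
    }

  const-⊛ : ∀ x f → const x ⊛ f ≋ x · f
  const-⊛ x f n = trans (·-⊛ x 𝟙 f n) (*-cong refl (⊛-identityˡ f n))

  const-* : ∀ x y → const x ⊛ const y ≋ const (x * y)
  const-* x y n = trans (const-⊛ x (const y) n) (sym (*-assoc _ _ _))

  const-cong : ∀ {x y} → x ≈ y → const x ≋ const y
  const-cong x≈y n = *-cong x≈y refl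

module RationalAlgebra {c ℓ} (R : CommutativeRing c ℓ) (φ : ℚ → CommutativeRing.Carrier R)
                       (hom : IsℚAlgebraMap R φ) where
  open CommutativeRing R
  open SetoidReasoning setoid
  open RingMorphisms.IsRingHomomorphism hom public using (⟦⟧-cong; +-homo; *-homo; 0#-homo; 1#-homo)
  open FiniteSums R φ public
  open CommutativeSemigroupProperties *-commutativeSemigroup using () renaming (interchange to *-interchange)

  infixr 8 _^_

  _^_ : Carrier → ℕ → Carrier
  _^_ = powR R φ

  ι : ℕ → Carrier
  ι n = φ (ℕ→ℚ n)

  ι-0 : ι 0 ≈ 0#
  ι-0 = 0#-homo

  ι-1 : ι 1 ≈ 1#
  ι-1 = 1#-homo

  ι-+ : ∀ m n → ι (m ℕ.+ n) ≈ ι m + ι n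
  ι-+ m n = trans (⟦⟧-cong (ℕ→ℚ-+ m n)) (+-homo (ℕ→ℚ m) (ℕ→ℚ n))

  ι-suc : ∀ n → ι (suc n) ≈ 1# + ι n
  ι-suc n = trans (ι-+ 1 n) (+-cong ι-1 refl)

  ι-* : ∀ m n → ι (m ℕ.* n) ≈ ι m * ι n
  ι-* zero    n = trans ι-0 (sym (trans (*-cong ι-0 refl) (zeroˡ _)))
  ι-* (suc m) n = begin
    ι (n ℕ.+ m ℕ.* n)        ≈⟨ ι-+ n (m ℕ.* n) ⟩
    ι n + ι (m ℕ.* n)        ≈⟨ +-cong (sym (*-identityˡ _)) (ι-* m n) ⟩
    1# * ι n + ι m * ι n     ≈⟨ distribʳ _ _ _ ⟨
    (1# + ι m) * ι n         ≈⟨ *-cong (ι-suc m) refl ⟨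
    ι (suc m) * ι n          ∎

  ^-cong : ∀ {x y} n → x ≈ y → x ^ n ≈ y ^ n
  ^-cong zero    x≈y = refl
  ^-cong (suc n) x≈y = *-cong x≈y (^-cong n x≈y)

  ^-distrib-* : ∀ x y n → (x * y) ^ n ≈ x ^ n * y ^ n
  ^-distrib-* x y zero    = sym (*-identityˡ 1#)
  ^-distrib-* x y (suc n) = trans (*-cong refl (^-distrib-* x y n)) (*-interchange x y (x ^ n) (y ^ n))

  1^n≈1 : ∀ n → 1# ^ n ≈ 1#
  1^n≈1 zero    = refl
  1^n≈1 (suc n) = trans (*-identityˡ _) (1^n≈1 n)

  ι-^ : ∀ m n → ι (m ℕ.^ n) ≈ ι m ^ n
  ι-^ m zero    = ι-1
  ι-^ m (suc n) = trans (ι-* m (m ℕ.^ n)) (*-cong refl (ι-^ m n))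

  φ-1/k*ι-k : ∀ k .{{_ : NonZero k}} → φ (+ 1 ℚ./ k) * ι k ≈ 1#
  φ-1/k*ι-k k = begin
    φ (+ 1 ℚ./ k) * ι k             ≈⟨ *-homo _ _ ⟨
    φ ((+ 1 ℚ./ k) ℚ.* ℕ→ℚ k)       ≈⟨ ⟦⟧-cong (≡.trans (ℚP.*-comm _ (ℕ→ℚ k)) (ℕ→ℚ-*-/ k 1)) ⟩
    ι 1                             ≈⟨ ι-1 ⟩
    1#                              ∎

  φ-sum : ∀ n f → φ (ℚSums.∑ n f) ≈ ∑ n (φ ∘ f)
  φ-sum zero    f = 0#-homo
  φ-sum (suc n) f = trans (+-homo _ _) (+-cong (φ-sum n f) refl)

module Exponentials {c ℓ} (R : CommutativeRing c ℓ) (φ : ℚ → CommutativeRing.Carrier R)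
                    (hom : IsℚAlgebraMap R φ) where
  open CommutativeRing R
  open SetoidReasoning setoid
  open RationalAlgebra R φ hom
  open ExponentialSeries R
  open RingProperties ring using (-‿distribʳ-*; -0#≈0#)
  module SeriesSums = FiniteSums seriesRing (const ∘ φ)
  module SeriesRingProperties = RingProperties (CommutativeRing.ring seriesRing)

  binomialConvolution : Series → Series → Series
  binomialConvolution f g n = ∑[ k < suc n ] (ι (n C k) * f k * g (n ∸ k))

  binomialConvolution-suc : ∀ f g n →
    binomialConvolution f g (suc n) ≈ binomialConvolution (∂ f) g n + binomialConvolution f (∂ g) n
  binomialConvolution-suc f g n = begin
    ∑ (suc (suc n)) T                              ≈⟨ sum-head (suc n) T ⟩
    T 0 + ∑ (suc n) (T ∘ suc)                      ≈⟨ +-cong refl (sum-cong (suc n) pascal) ⟩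
    T 0 + ∑[ k < suc n ] (U k + V (suc k))         ≈⟨ +-cong refl (sum-+ (suc n) U (V ∘ suc)) ⟩
    T 0 + (∑ (suc n) U + (∑ n (V ∘ suc) + V (suc n)))
                                                   ≈⟨ +-cong refl (+-cong refl (trans (+-cong refl V-last) (+-identityʳ _))) ⟩
    T 0 + (∑ (suc n) U + ∑ n (V ∘ suc))            ≈⟨ +-cong refl (+-comm _ _) ⟩
    T 0 + (∑ n (V ∘ suc) + ∑ (suc n) U)            ≈⟨ +-assoc _ _ _ ⟨
    (V 0 + ∑ n (V ∘ suc)) + ∑ (suc n) U            ≈⟨ +-cong (sum-head n V) refl ⟨
    ∑ (suc n) V + ∑ (suc n) U                      ≈⟨ +-cong (sum-cong< (suc n) V≈) refl ⟩
    binomialConvolution f (∂ g) n + ∑ (suc n) U    ≈⟨ +-comm _ _ ⟩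
    binomialConvolution (∂ f) g n + binomialConvolution f (∂ g) n ∎
    where
    T U V : ℕ → Carrier
    T k = ι (suc n C k) * f k * g (suc n ∸ k)
    U k = ι (n C k) * f (suc k) * g (n ∸ k)
    V k = ι (n C k) * f k * g (suc n ∸ k)
    pascal : ∀ k → T (suc k) ≈ U k + V (suc k)
    pascal k = begin
      ι (suc n C suc k) * f (suc k) * g (n ∸ k)
        ≈⟨ *-cong (*-cong (⟦⟧-cong (cong ℕ→ℚ (nCk+nC[k+1]≡[n+1]C[k+1] n k))) refl) refl ⟨
      ι (n C k ℕ.+ n C suc k) * f (suc k) * g (n ∸ k)
        ≈⟨ *-cong (*-cong (ι-+ (n C k) (n C suc k)) refl) refl ⟩
      (ι (n C k) + ι (n C suc k)) * f (suc k) * g (n ∸ k)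
        ≈⟨ trans (*-cong (distribʳ _ _ _) refl) (distribʳ _ _ _) ⟩
      U k + V (suc k) ∎
    V-last : V (suc n) ≈ 0#
    V-last = begin
      ι (n C suc n) * f (suc n) * g _   ≈⟨ *-cong (*-cong (⟦⟧-cong (cong ℕ→ℚ (k>n⇒nCk≡0 (ℕP.n<1+n n)))) refl) refl ⟩
      ι 0 * f (suc n) * g _             ≈⟨ *-cong (*-cong ι-0 refl) refl ⟩
      0# * f (suc n) * g _              ≈⟨ trans (*-cong (zeroˡ _) refl) (zeroˡ _) ⟩
      0#                                ∎
    V≈ : ∀ k → k < suc n → V k ≈ ι (n C k) * f k * g (suc (n ∸ k))
    V≈ k (s≤s k≤n) = reflexive (cong (λ j → ι (n C k) * f k * g j) (ℕP.+-∸-assoc 1 k≤n))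

  ⊛-binomial : ∀ f g n → (f ⊛ g) n ≈ binomialConvolution f g n
  ⊛-binomial f g zero    = sym (trans (+-identityˡ _) (*-cong (trans (*-cong ι-1 refl) (*-identityˡ _)) refl))
  ⊛-binomial f g (suc n) =
    trans (+-cong (⊛-binomial (∂ f) g n) (⊛-binomial f (∂ g) n)) (sym (binomialConvolution-suc f g n))

  exp : Carrier → Series
  exp x n = x ^ n

  exp-cong : ∀ {x y} → x ≈ y → exp x ≋ exp y
  exp-cong x≈y n = ^-cong n x≈y

  exp-0 : exp 0# ≋ 𝟙
  exp-0 zero    = refl
  exp-0 (suc n) = zeroˡ _

  exp-+ : ∀ x y → exp x ⊛ exp y ≋ exp (x + y)
  exp-+ x y zero    = *-identityˡ 1#
  exp-+ x y (suc n) = begin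
    (x · exp x ⊛ exp y) n + (exp x ⊛ y · exp y) n   ≈⟨ +-cong (·-⊛ x (exp x) (exp y) n) (⊛-· y (exp x) (exp y) n) ⟩
    x * (exp x ⊛ exp y) n + y * (exp x ⊛ exp y) n   ≈⟨ distribʳ _ x y ⟨
    (x + y) * (exp x ⊛ exp y) n                     ≈⟨ *-cong refl (exp-+ x y n) ⟩
    (x + y) * (x + y) ^ n                           ∎

  -- The substitution t ↦ u t.
  scale : Carrier → Series → Series
  scale u f n = u ^ n * f n

  scale-cong : ∀ {u v f g} → u ≈ v → f ≋ g → scale u f ≋ scale v g
  scale-cong u≈v f≋g n = *-cong (^-cong n u≈v) (f≋g n)

  scale-⊛ : ∀ u f g → scale u (f ⊛ g) ≋ scale u f ⊛ scale u g
  scale-⊛ u f g zero    = trans (*-identityˡ _) (sym (*-cong (*-identityˡ _) (*-identityˡ _)))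
  scale-⊛ u f g (suc n) = begin
    u * u ^ n * ((∂ f ⊛ g) n + (f ⊛ ∂ g) n)
      ≈⟨ *-assoc _ _ _ ⟩
    u * (u ^ n * ((∂ f ⊛ g) n + (f ⊛ ∂ g) n))
      ≈⟨ *-cong refl (distribˡ _ _ _) ⟩
    u * (scale u (∂ f ⊛ g) n + scale u (f ⊛ ∂ g) n)
      ≈⟨ *-cong refl (+-cong (scale-⊛ u (∂ f) g n) (scale-⊛ u f (∂ g) n)) ⟩
    u * ((scale u (∂ f) ⊛ scale u g) n + (scale u f ⊛ scale u (∂ g)) n)
      ≈⟨ distribˡ u _ _ ⟩
    u * (scale u (∂ f) ⊛ scale u g) n + u * (scale u f ⊛ scale u (∂ g)) n
      ≈⟨ +-cong (·-⊛ u _ _ n) (⊛-· u _ _ n) ⟨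
    (u · scale u (∂ f) ⊛ scale u g) n + (scale u f ⊛ u · scale u (∂ g)) n
      ≈⟨ +-cong (⊛-cong (∂-scale f) ≋-refl n) (⊛-cong ≋-refl (∂-scale g) n) ⟩
    (∂ (scale u f) ⊛ scale u g) n + (scale u f ⊛ ∂ (scale u g)) n
      ∎
    where
    ∂-scale : ∀ h → u · scale u (∂ h) ≋ ∂ (scale u h)
    ∂-scale h m = sym (*-assoc _ _ _)

  scale-scale : ∀ u v f → scale u (scale v f) ≋ scale (u * v) f
  scale-scale u v f n = trans (sym (*-assoc _ _ _)) (*-cong (sym (^-distrib-* u v n)) refl)

  scale-exp : ∀ u x → scale u (exp x) ≋ exp (u * x)
  scale-exp u x n = sym (^-distrib-* u x n)

  scale-𝟙 : ∀ u → scale u 𝟙 ≋ 𝟙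
  scale-𝟙 u zero    = *-identityˡ 1#
  scale-𝟙 u (suc n) = zeroʳ _

  scale-X : ∀ u → scale u X ≋ const u ⊛ X
  scale-X u n = trans (scale-X-at n) (sym (const-⊛ u X n))
    where
    scale-X-at : ∀ n → scale u X n ≈ u * X n
    scale-X-at 0             = trans (zeroʳ _) (sym (zeroʳ _))
    scale-X-at 1             = *-cong (*-identityʳ u) refl
    scale-X-at (suc (suc n)) = trans (zeroʳ _) (sym (zeroʳ _))

  sum-apply : ∀ a H n → SeriesSums.∑ a H n ≈ ∑[ i < a ] H i n
  sum-apply zero    H n = refl
  sum-apply (suc a) H n = +-cong (sum-apply a H n) refl

  scale-sum : ∀ u a H → scale u (SeriesSums.∑ a H) ≋ SeriesSums.∑[ i < a ] scale u (H i)
  scale-sum u a H n = begin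
    u ^ n * SeriesSums.∑ a H n           ≈⟨ *-cong refl (sum-apply a H n) ⟩
    u ^ n * ∑[ i < a ] H i n             ≈⟨ sum-distribˡ a _ _ ⟩
    ∑[ i < a ] (u ^ n * H i n)           ≈⟨ sum-apply a (λ i → scale u (H i)) n ⟨
    (SeriesSums.∑[ i < a ] scale u (H i)) n ∎

  expm1 : Carrier → Series
  expm1 u = exp u ⊕ ⊝ 𝟙

  expm1-cong : ∀ {u v} → u ≈ v → expm1 u ≋ expm1 v
  expm1-cong u≈v n = +-cong (exp-cong u≈v n) refl

  expm1≋scale-expm1 : ∀ u → expm1 u ≋ scale u (expm1 1#)
  expm1≋scale-expm1 u n = sym (begin
    u ^ n * (1# ^ n + - 𝟙 n)       ≈⟨ distribˡ _ _ _ ⟩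
    u ^ n * 1# ^ n + u ^ n * - 𝟙 n ≈⟨ +-cong (trans (*-cong refl (1^n≈1 n)) (*-identityʳ _)) (sym (-‿distribʳ-* _ _)) ⟩
    u ^ n + - (u ^ n * 𝟙 n)        ≈⟨ +-cong refl (-‿cong (scale-𝟙 u n)) ⟩
    u ^ n + - 𝟙 n                  ∎)

  expm1-⊛-sum-exp : ∀ u a → expm1 u ⊛ SeriesSums.∑[ i < a ] exp (u * ι i) ≋ expm1 (u * ι a)
  expm1-⊛-sum-exp u zero n = begin
    (expm1 u ⊛ 𝟘) n      ≈⟨ trans (⊛-comm (expm1 u) 𝟘 n) (⊛-zeroˡ (expm1 u) n) ⟩
    0#                   ≈⟨ -‿inverseʳ _ ⟨
    𝟙 n + - 𝟙 n          ≈⟨ +-cong (trans (exp-cong (trans (*-cong refl ι-0) (zeroʳ u)) n) (exp-0 n)) refl ⟨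
    expm1 (u * ι 0) n    ∎
  expm1-⊛-sum-exp u (suc a) n = begin
    (expm1 u ⊛ (SeriesSums.∑ a H ⊕ H a)) n
      ≈⟨ ⊛-distribˡ (expm1 u) (SeriesSums.∑ a H) (H a) n ⟩
    (expm1 u ⊛ SeriesSums.∑ a H) n + (expm1 u ⊛ H a) n
      ≈⟨ +-cong (expm1-⊛-sum-exp u a n) (⊛-distribʳ (H a) (exp u) (⊝ 𝟙) n) ⟩
    (p + - 𝟙 n) + ((exp u ⊛ H a) n + (⊝ 𝟙 ⊛ H a) n)
      ≈⟨ +-cong refl (+-cong (exp-+ u (u * ι a) n) (trans (sym (SeriesRingProperties.-‿distribˡ-* 𝟙 (H a) n)) (-‿cong (⊛-identityˡ (H a) n)))) ⟩
    (p + - 𝟙 n) + (q + - p)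
      ≈⟨ +-comm _ _ ⟩
    (q + - p) + (p + - 𝟙 n)
      ≈⟨ +-assoc _ _ _ ⟩
    q + (- p + (p + - 𝟙 n))
      ≈⟨ +-cong refl (trans (sym (+-assoc _ _ _)) (trans (+-cong (-‿inverseˡ p) refl) (+-identityˡ _))) ⟩
    q + - 𝟙 n
      ≈⟨ +-cong (exp-cong u+u*ι-a≈u*ι-suc-a n) refl ⟩
    expm1 (u * ι (suc a)) n ∎
    where
    H : ℕ → Series
    H i = exp (u * ι i)
    p = (u * ι a) ^ n
    q = (u + u * ι a) ^ n
    u+u*ι-a≈u*ι-suc-a : u + u * ι a ≈ u * ι (suc a)
    u+u*ι-a≈u*ι-suc-a = trans (+-cong (sym (*-identityʳ u)) refl) (trans (sym (distribˡ u 1# (ι a))) (*-cong refl (sym (ι-suc a))))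

  expm1-⊛-leading : ∀ u f n → (∀ {j} → j < n → f j ≈ 0#) → (expm1 u ⊛ f) (suc n) ≈ ι (suc n) * u * f n
  expm1-⊛-leading u f n f<n≈0 = begin
    (expm1 u ⊛ f) (suc n)                    ≈⟨ ⊛-binomial (expm1 u) f (suc n) ⟩
    ∑ (suc (suc n)) T                         ≈⟨ sum-head (suc n) T ⟩
    T 0 + ∑ (suc n) (T ∘ suc)                 ≈⟨ +-cong T₀≈0 (sum-head n (T ∘ suc)) ⟩
    0# + (T 1 + ∑[ j < n ] T (suc (suc j)))   ≈⟨ +-identityˡ _ ⟩
    T 1 + ∑[ j < n ] T (suc (suc j))          ≈⟨ +-cong T₁≈ (sum-zero n T₂₊≈0) ⟩
    ι (suc n) * u * f n + 0#                  ≈⟨ +-identityʳ _ ⟩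
    ι (suc n) * u * f n                       ∎
    where
    T : ℕ → Carrier
    T j = ι (suc n C j) * expm1 u j * f (suc n ∸ j)
    T₀≈0 : T 0 ≈ 0#
    T₀≈0 = trans (*-cong (trans (*-cong refl (-‿inverseʳ 1#)) (zeroʳ _)) refl) (zeroˡ _)
    T₁≈ : T 1 ≈ ι (suc n) * u * f n
    T₁≈ = *-cong (*-cong (⟦⟧-cong (cong ℕ→ℚ (nC1≡n (suc n)))) (trans (+-cong (*-identityʳ u) -0#≈0#) (+-identityʳ u))) refl
    T₂₊≈0 : ∀ j → j < n → T (suc (suc j)) ≈ 0#
    T₂₊≈0 j j<n = trans (*-cong refl (f<n≈0 (ℕP.∸-monoʳ-< (s≤s ℕ.z≤n) j<n))) (zeroʳ _)

  -- The coefficient of t in expm1 u is the unit u, so the lowest nonzero coefficient fₙ of f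
  -- reappears, times (n+1) u, in expm1 u ⊛ f.
  expm1-⊛≋𝟘⇒≋𝟘 : ∀ k .{{_ : NonZero k}} {u} → u ≈ ι k → ∀ f → expm1 u ⊛ f ≋ 𝟘 → f ≋ 𝟘
  expm1-⊛≋𝟘⇒≋𝟘 k {u} u≈ι-k f expm1⊛f≋𝟘 = <-rec _ vanishes
    where
    vanishes : ∀ n → (∀ {j} → j < n → f j ≈ 0#) → f n ≈ 0#
    vanishes n f<n≈0 = begin
      f n                                 ≈⟨ *-identityˡ (f n) ⟨
      1# * f n                            ≈⟨ *-cong (φ-1/k*ι-k (suc n ℕ.* k)) refl ⟨
      v * ι (suc n ℕ.* k) * f n           ≈⟨ *-cong (*-cong refl (trans (ι-* (suc n) k) (*-cong refl (sym u≈ι-k)))) refl ⟩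
      v * (ι (suc n) * u) * f n           ≈⟨ *-assoc _ _ _ ⟩
      v * (ι (suc n) * u * f n)           ≈⟨ *-cong refl (expm1-⊛-leading u f n f<n≈0) ⟨
      v * (expm1 u ⊛ f) (suc n)           ≈⟨ *-cong refl (expm1⊛f≋𝟘 (suc n)) ⟩
      v * 0#                              ≈⟨ zeroʳ v ⟩
      0#                                  ∎
      where
      instance _ = ℕP.m*n≢0 (suc n) k
      v = φ (+ 1 ℚ./ (suc n ℕ.* k))

  expm1-cancelˡ : ∀ k .{{_ : NonZero k}} {u} → u ≈ ι k → ∀ {f g} → expm1 u ⊛ f ≋ expm1 u ⊛ g → f ≋ g
  expm1-cancelˡ k {u} u≈ι-k {f} {g} eq = SeriesRingProperties.x∙y⁻¹≈ε⇒x≈y f g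
    (expm1-⊛≋𝟘⇒≋𝟘 k u≈ι-k (f ⊕ ⊝ g) (λ n → begin
      (expm1 u ⊛ (f ⊕ ⊝ g)) n                 ≈⟨ ⊛-distribˡ (expm1 u) f (⊝ g) n ⟩
      (expm1 u ⊛ f) n + (expm1 u ⊛ ⊝ g) n    ≈⟨ +-cong (eq n) (sym (SeriesRingProperties.-‿distribʳ-* (expm1 u) g n)) ⟩
      (expm1 u ⊛ g) n + - (expm1 u ⊛ g) n    ≈⟨ -‿inverseʳ _ ⟩
      0#                                     ∎))

module BernoulliSeries {c ℓ} (R : CommutativeRing c ℓ) (φ : ℚ → CommutativeRing.Carrier R)
                       (hom : IsℚAlgebraMap R φ) where
  open CommutativeRing R
  open SetoidReasoning setoid
  open RationalAlgebra R φ hom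
  open ExponentialSeries R
  open Exponentials R φ hom

  bernoulli : Series
  bernoulli n = φ (bern n)

  bernPoly-egf : ∀ m x → bernPoly R φ m x ≈ (exp x ⊛ bernoulli) m
  bernPoly-egf m x = begin
    ∑[ k < suc m ] (φ (ℕ→ℚ (m C k) ℚ.* bern (m ∸ k)) * x ^ k)   ≈⟨ sum-cong (suc m) reorder ⟩
    binomialConvolution (exp x) bernoulli m                       ≈⟨ ⊛-binomial (exp x) bernoulli m ⟨
    (exp x ⊛ bernoulli) m                                         ∎
    where
    reorder : ∀ k → φ (ℕ→ℚ (m C k) ℚ.* bern (m ∸ k)) * x ^ k ≈ ι (m C k) * x ^ k * φ (bern (m ∸ k))
    reorder k = begin
      φ (ℕ→ℚ (m C k) ℚ.* bern (m ∸ k)) * x ^ k        ≈⟨ *-cong (*-homo _ _) refl ⟩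
      ι (m C k) * φ (bern (m ∸ k)) * x ^ k            ≈⟨ *-assoc _ _ _ ⟩
      ι (m C k) * (φ (bern (m ∸ k)) * x ^ k)          ≈⟨ *-cong refl (*-comm _ _) ⟩
      ι (m C k) * (x ^ k * φ (bern (m ∸ k)))          ≈⟨ *-assoc _ _ _ ⟨
      ι (m C k) * x ^ k * φ (bern (m ∸ k))            ∎

  sum-binomial-bern : ∀ n → ∑[ k < n ] φ (ℕ→ℚ (n C k) ℚ.* bern k) ≈ X n
  sum-binomial-bern 0             = refl
  sum-binomial-bern 1             = trans (+-identityˡ _) 1#-homo
  sum-binomial-bern (suc (suc m)) = trans (sym (φ-sum (suc (suc m)) _)) (trans (⟦⟧-cong (bern-recurrence m)) 0#-homo)

  bernoulli-⊛-exp-1 : ∀ n → (bernoulli ⊛ exp 1#) n ≈ ∑[ k < n ] φ (ℕ→ℚ (n C k) ℚ.* bern k) + bernoulli n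
  bernoulli-⊛-exp-1 n = begin
    (bernoulli ⊛ exp 1#) n                               ≈⟨ ⊛-binomial bernoulli (exp 1#) n ⟩
    ∑[ k < suc n ] (ι (n C k) * bernoulli k * 1# ^ (n ∸ k))
      ≈⟨ sum-cong (suc n) (λ k → trans (trans (*-cong refl (1^n≈1 (n ∸ k))) (*-identityʳ _)) (sym (*-homo _ _))) ⟩
    ∑[ k < n ] φ (ℕ→ℚ (n C k) ℚ.* bern k) + φ (ℕ→ℚ (n C n) ℚ.* bern n)
      ≈⟨ +-cong refl (⟦⟧-cong (≡.trans (cong (λ m → ℕ→ℚ m ℚ.* bern n) (nCn≡1 n)) (ℚP.*-identityˡ (bern n)))) ⟩
    ∑[ k < n ] φ (ℕ→ℚ (n C k) ℚ.* bern k) + bernoulli n  ∎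

  bernoulli-egf : bernoulli ⊛ expm1 1# ≋ X
  bernoulli-egf n = begin
    (bernoulli ⊛ (exp 1# ⊕ ⊝ 𝟙)) n                    ≈⟨ ⊛-distribˡ bernoulli (exp 1#) (⊝ 𝟙) n ⟩
    (bernoulli ⊛ exp 1#) n + (bernoulli ⊛ ⊝ 𝟙) n      ≈⟨ +-cong (bernoulli-⊛-exp-1 n) bernoulli-⊛-⊝𝟙 ⟩
    (s + bernoulli n) + - bernoulli n                 ≈⟨ +-assoc _ _ _ ⟩
    s + (bernoulli n + - bernoulli n)                 ≈⟨ +-cong refl (-‿inverseʳ _) ⟩
    s + 0#                                            ≈⟨ +-identityʳ _ ⟩
    s                                                 ≈⟨ sum-binomial-bern n ⟩
    X n                                               ∎
    where
    s = ∑[ k < n ] φ (ℕ→ℚ (n C k) ℚ.* bern k)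
    bernoulli-⊛-⊝𝟙 : (bernoulli ⊛ ⊝ 𝟙) n ≈ - bernoulli n
    bernoulli-⊛-⊝𝟙 = begin
      (bernoulli ⊛ ⊝ 𝟙) n     ≈⟨ SeriesRingProperties.-‿distribʳ-* bernoulli 𝟙 n ⟨
      - (bernoulli ⊛ 𝟙) n     ≈⟨ -‿cong (trans (⊛-comm bernoulli 𝟙 n) (⊛-identityˡ bernoulli n)) ⟩
      - bernoulli n           ∎

  scale-bernoulli-egf : ∀ u → scale u bernoulli ⊛ expm1 u ≋ const u ⊛ X
  scale-bernoulli-egf u n = begin
    (scale u bernoulli ⊛ expm1 u) n                 ≈⟨ ⊛-cong ≋-refl (expm1≋scale-expm1 u) n ⟩
    (scale u bernoulli ⊛ scale u (expm1 1#)) n      ≈⟨ scale-⊛ u bernoulli (expm1 1#) n ⟨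
    scale u (bernoulli ⊛ expm1 1#) n                ≈⟨ scale-cong refl bernoulli-egf n ⟩
    scale u X n                                     ≈⟨ scale-X u n ⟩
    (const u ⊛ X) n                                 ∎

  scale-bernPoly-egf : ∀ u x → scale u (exp x ⊛ bernoulli) ≋ exp (u * x) ⊛ scale u bernoulli
  scale-bernPoly-egf u x n = trans (scale-⊛ u (exp x) bernoulli n) (⊛-cong (scale-exp u x) ≋-refl n)

module TripleSymmetry {c ℓ} (R : CommutativeRing c ℓ) (φ : ℚ → CommutativeRing.Carrier R)
                      (hom : IsℚAlgebraMap R φ) (y₁ y₂ : CommutativeRing.Carrier R) where
  open CommutativeRing R
  open RationalAlgebra R φ hom
  open ExponentialSeries R
  open Exponentials R φ hom
  open BernoulliSeries R φ hom
  open CommutativeMonoidSolver *-commutativeMonoid using (_⊜_) renaming (solve to *-solve; _⊕_ to _⊙_)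
  module ⊛-Solver = CommutativeMonoidSolver (CommutativeRing.*-commutativeMonoid seriesRing)
  open ⊛-Solver using () renaming (solve to ⊛-solve; _⊕_ to _⊚_; _⊜_ to _⊜ₛ_)
  private module ≋-Reasoning = SetoidReasoning (CommutativeRing.setoid seriesRing)

  E : (a b c : ℕ) → .{{NonZero a}} → Series
  E a b c n = bigE R φ n a b c y₁ y₂

  Δ : Carrier → Carrier → Carrier → Series
  Δ x y z = expm1 (x * y) ⊛ expm1 (x * z) ⊛ expm1 (y * z)

  W : Carrier → Series
  W m = const m ⊛ X ⊛ X ⊛ expm1 m ⊛ exp (m * y₁) ⊛ exp (m * y₂)

  W-cong : ∀ {m m′} → m ≈ m′ → W m ≋ W m′
  W-cong m≈m′ = ⊛-cong (⊛-cong (⊛-cong (⊛-cong (⊛-cong (const-cong m≈m′) ≋-refl) ≋-refl) (expm1-cong m≈m′))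
                         (exp-cong (*-cong m≈m′ refl))) (exp-cong (*-cong m≈m′ refl))

  Δ-comm₂₃ : ∀ x y z → Δ x y z ≋ Δ x z y
  Δ-comm₂₃ x y z n = trans (⊛-solve 3 (λ e₁ e₂ e₃ → (e₁ ⊚ e₂) ⊚ e₃ ⊜ₛ (e₂ ⊚ e₁) ⊚ e₃) ≋-refl
                                      (expm1 (x * y)) (expm1 (x * z)) (expm1 (y * z)) n)
                           (⊛-cong ≋-refl (expm1-cong (*-comm y z)) n)

  Δ-comm₁₂ : ∀ x y z → Δ x y z ≋ Δ y x z
  Δ-comm₁₂ x y z n = trans (⊛-solve 3 (λ e₁ e₂ e₃ → (e₁ ⊚ e₂) ⊚ e₃ ⊜ₛ (e₁ ⊚ e₃) ⊚ e₂) ≋-refl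
                                      (expm1 (x * y)) (expm1 (x * z)) (expm1 (y * z)) n)
                           (⊛-cong (⊛-cong (expm1-cong (*-comm x y)) ≋-refl) ≋-refl n)

  module _ (a b c : ℕ) .{{_ : NonZero a}} .{{_ : NonZero b}} .{{_ : NonZero c}} where
    private
      α β γ v m : Carrier
      α = ι a
      β = ι b
      γ = ι c
      v = φ (+ 1 ℚ./ a)
      m = α * β * γ

      z : ℕ → Carrier
      z i = β * y₂ + φ ((+ b ℚ./ a) ℚ.* ℕ→ℚ i)

      F G : Series
      F = scale β (exp (γ * y₁) ⊛ bernoulli)
      G = scale γ (SeriesSums.∑[ i < a ] (exp (z i) ⊛ bernoulli))

    powPred≈ : ∀ n → φ (powPred R φ a n) ≈ v * α ^ n
    powPred≈ zero    = sym (*-identityʳ v)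
    powPred≈ (suc n) = begin
      ι (a ℕ.^ n)           ≈⟨ ι-^ a n ⟩
      α ^ n                 ≈⟨ *-identityˡ _ ⟨
      1# * α ^ n            ≈⟨ *-cong (φ-1/k*ι-k a) refl ⟨
      v * α * α ^ n         ≈⟨ *-assoc v α (α ^ n) ⟩
      v * (α * α ^ n)       ∎
      where open SetoidReasoning setoid

    -- a^{n−1} = aⁿ / a, and the weights c^{n−k} b^k rescale t in the two Bernoulli factors.
    E≋scale-F⊛G : E a b c ≋ const v ⊛ scale α (F ⊛ G)
    E≋scale-F⊛G n = begin
      φ (powPred R φ a n) * ∑ (suc n) T             ≈⟨ *-cong (powPred≈ n) (sum-cong (suc n) T≈) ⟩
      v * α ^ n * binomialConvolution F G n         ≈⟨ *-cong refl (⊛-binomial F G n) ⟨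
      v * α ^ n * (F ⊛ G) n                         ≈⟨ *-assoc v (α ^ n) _ ⟩
      v * scale α (F ⊛ G) n                         ≈⟨ const-⊛ v (scale α (F ⊛ G)) n ⟨
      (const v ⊛ scale α (F ⊛ G)) n                 ∎
      where
      open SetoidReasoning setoid
      T : ℕ → Carrier
      T k = ι (n C k) * bernPoly R φ k (γ * y₁) * ∑[ i < a ] bernPoly R φ (n ∸ k) (z i) * ι (c ℕ.^ (n ∸ k) ℕ.* b ℕ.^ k)
      T≈ : ∀ k → T k ≈ ι (n C k) * F k * G (n ∸ k)
      T≈ k = begin
        T k
          ≈⟨ *-cong (*-cong (*-cong refl (bernPoly-egf k (γ * y₁)))
                            (sum-cong a (λ i → bernPoly-egf (n ∸ k) (z i))))
                    (trans (ι-* (c ℕ.^ (n ∸ k)) (b ℕ.^ k)) (*-cong (ι-^ c (n ∸ k)) (ι-^ b k))) ⟩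
        ι (n C k) * p * s * (γ ^ (n ∸ k) * β ^ k)
          ≈⟨ *-solve 5 (λ x p s g b → ((x ⊙ p) ⊙ s) ⊙ (g ⊙ b) ⊜ (x ⊙ (b ⊙ p)) ⊙ (g ⊙ s)) refl (ι (n C k)) p s (γ ^ (n ∸ k)) (β ^ k) ⟩
        ι (n C k) * (β ^ k * p) * (γ ^ (n ∸ k) * s)
          ≈⟨ *-cong refl (*-cong refl (sum-apply a (λ i → exp (z i) ⊛ bernoulli) (n ∸ k))) ⟨
        ι (n C k) * F k * G (n ∸ k) ∎
        where
        p = (exp (γ * y₁) ⊛ bernoulli) k
        s = ∑[ i < a ] (exp (z i) ⊛ bernoulli) (n ∸ k)

    scale-F : scale α F ≋ exp (α * β * (γ * y₁)) ⊛ scale (α * β) bernoulli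
    scale-F n = trans (scale-scale α β (exp (γ * y₁) ⊛ bernoulli) n) (scale-bernPoly-egf (α * β) (γ * y₁) n)

    α*γ*z≈ : ∀ i → α * γ * z i ≈ m * y₂ + β * γ * ι i
    α*γ*z≈ i = begin
      α * γ * (β * y₂ + φ (q ℚ.* ℕ→ℚ i))          ≈⟨ distribˡ _ _ _ ⟩
      α * γ * (β * y₂) + α * γ * φ (q ℚ.* ℕ→ℚ i)  ≈⟨ +-cong (*-solve 4 (λ a g b y → (a ⊙ g) ⊙ (b ⊙ y) ⊜ ((a ⊙ b) ⊙ g) ⊙ y) refl α γ β y₂)
                                                            (*-cong refl (*-homo q (ℕ→ℚ i))) ⟩
      m * y₂ + α * γ * (φ q * ι i)               ≈⟨ +-cong refl (*-solve 4 (λ a g p i → (a ⊙ g) ⊙ (p ⊙ i) ⊜ ((a ⊙ p) ⊙ g) ⊙ i) refl α γ (φ q) (ι i)) ⟩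
      m * y₂ + α * φ q * γ * ι i                 ≈⟨ +-cong refl (*-cong (*-cong α*φq≈β refl) refl) ⟩
      m * y₂ + β * γ * ι i                       ∎
      where
      open SetoidReasoning setoid
      q = + b ℚ./ a
      α*φq≈β : α * φ q ≈ β
      α*φq≈β = trans (sym (*-homo _ _)) (⟦⟧-cong (ℕ→ℚ-*-/ a b))

    scale-G : scale α G ≋ exp (m * y₂) ⊛ scale (α * γ) bernoulli ⊛ SeriesSums.∑[ i < a ] exp (β * γ * ι i)
    scale-G = begin
      scale α (scale γ (SeriesSums.∑[ i < a ] (exp (z i) ⊛ bernoulli)))
        ≈⟨ scale-scale α γ _ ⟩
      scale (α * γ) (SeriesSums.∑[ i < a ] (exp (z i) ⊛ bernoulli))
        ≈⟨ scale-sum (α * γ) a _ ⟩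
      SeriesSums.∑[ i < a ] scale (α * γ) (exp (z i) ⊛ bernoulli)
        ≈⟨ SeriesSums.sum-cong a summand≋ ⟩
      SeriesSums.∑[ i < a ] (exp (m * y₂) ⊛ scale (α * γ) bernoulli ⊛ exp (β * γ * ι i))
        ≈⟨ SeriesSums.sum-distribˡ a _ _ ⟨
      exp (m * y₂) ⊛ scale (α * γ) bernoulli ⊛ SeriesSums.∑[ i < a ] exp (β * γ * ι i) ∎
      where
      open ≋-Reasoning
      summand≋ : ∀ i → scale (α * γ) (exp (z i) ⊛ bernoulli) ≋ exp (m * y₂) ⊛ scale (α * γ) bernoulli ⊛ exp (β * γ * ι i)
      summand≋ i = begin
        scale (α * γ) (exp (z i) ⊛ bernoulli)                              ≈⟨ scale-bernPoly-egf (α * γ) (z i) ⟩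
        exp (α * γ * z i) ⊛ scale (α * γ) bernoulli                        ≈⟨ ⊛-cong (exp-cong (α*γ*z≈ i)) ≋-refl ⟩
        exp (m * y₂ + β * γ * ι i) ⊛ scale (α * γ) bernoulli               ≈⟨ ⊛-cong (exp-+ (m * y₂) (β * γ * ι i)) ≋-refl ⟨
        exp (m * y₂) ⊛ exp (β * γ * ι i) ⊛ scale (α * γ) bernoulli
          ≈⟨ ⊛-solve 3 (λ p e s → (p ⊚ e) ⊚ s ⊜ₛ (p ⊚ s) ⊚ e) ≋-refl (exp (m * y₂)) (exp (β * γ * ι i)) (scale (α * γ) bernoulli) ⟩
        exp (m * y₂) ⊛ scale (α * γ) bernoulli ⊛ exp (β * γ * ι i)         ∎

    -- Each factor eᵘᵗ − 1 of Δ meets its Bernoulli series (giving u t) or its geometric sum.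
    Δ-⊛-scale-F⊛G : Δ α β γ ⊛ scale α (F ⊛ G) ≋ const α ⊛ W m
    Δ-⊛-scale-F⊛G = begin
      Δ α β γ ⊛ scale α (F ⊛ G)
        ≈⟨ ⊛-cong ≋-refl (λ n → trans (scale-⊛ α F G n) (⊛-cong scale-F scale-G n)) ⟩
      Δ α β γ ⊛ ((P₁ ⊛ b₁) ⊛ (P₂ ⊛ b₂ ⊛ Σ))
        ≈⟨ ⊛-solve 8 (λ e₁ e₂ e₃ p₁ b₁ p₂ b₂ σ →
                         ((e₁ ⊚ e₂) ⊚ e₃) ⊚ ((p₁ ⊚ b₁) ⊚ ((p₂ ⊚ b₂) ⊚ σ))
                      ⊜ₛ (((b₁ ⊚ e₁) ⊚ (b₂ ⊚ e₂)) ⊚ (e₃ ⊚ σ)) ⊚ (p₁ ⊚ p₂))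
                     ≋-refl (expm1 (α * β)) (expm1 (α * γ)) (expm1 (β * γ)) P₁ b₁ P₂ b₂ Σ ⟩
      ((b₁ ⊛ expm1 (α * β)) ⊛ (b₂ ⊛ expm1 (α * γ))) ⊛ (expm1 (β * γ) ⊛ Σ) ⊛ (P₁ ⊛ P₂)
        ≈⟨ ⊛-cong (⊛-cong (⊛-cong (scale-bernoulli-egf (α * β)) (scale-bernoulli-egf (α * γ))) (expm1-⊛-sum-exp (β * γ) a)) ≋-refl ⟩
      ((const (α * β) ⊛ X) ⊛ (const (α * γ) ⊛ X)) ⊛ expm1 (β * γ * α) ⊛ (P₁ ⊛ P₂)
        ≈⟨ ⊛-solve 6 (λ c₁ x c₂ e p₁ p₂ → (((c₁ ⊚ x) ⊚ (c₂ ⊚ x)) ⊚ e) ⊚ (p₁ ⊚ p₂)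
                                      ⊜ₛ (((((c₁ ⊚ c₂) ⊚ x) ⊚ x) ⊚ e) ⊚ p₁) ⊚ p₂)
                     ≋-refl (const (α * β)) X (const (α * γ)) (expm1 (β * γ * α)) P₁ P₂ ⟩
      const (α * β) ⊛ const (α * γ) ⊛ X ⊛ X ⊛ expm1 (β * γ * α) ⊛ P₁ ⊛ P₂
        ≈⟨ ⊛-cong (⊛-cong (⊛-cong constants≋ (expm1-cong β*γ*α≈m)) (exp-cong α*β*[γ*y₁]≈m*y₁)) ≋-refl ⟩
      const α ⊛ const m ⊛ X ⊛ X ⊛ expm1 m ⊛ exp (m * y₁) ⊛ P₂
        ≈⟨ ⊛-solve 6 (λ c₁ c₂ x e p₁ p₂ → (((((c₁ ⊚ c₂) ⊚ x) ⊚ x) ⊚ e) ⊚ p₁) ⊚ p₂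
                                      ⊜ₛ c₁ ⊚ (((((c₂ ⊚ x) ⊚ x) ⊚ e) ⊚ p₁) ⊚ p₂))
                     ≋-refl (const α) (const m) X (expm1 m) (exp (m * y₁)) P₂ ⟩
      const α ⊛ W m ∎
      where
      open ≋-Reasoning
      P₁ = exp (α * β * (γ * y₁))
      P₂ = exp (m * y₂)
      b₁ = scale (α * β) bernoulli
      b₂ = scale (α * γ) bernoulli
      Σ  = SeriesSums.∑[ i < a ] exp (β * γ * ι i)
      constants≋ : const (α * β) ⊛ const (α * γ) ⊛ X ⊛ X ≋ const α ⊛ const m ⊛ X ⊛ X
      constants≋ = ⊛-cong (⊛-cong (λ n → trans (const-* (α * β) (α * γ) n) (trans (const-cong
                     (*-solve 3 (λ a b g → (a ⊙ b) ⊙ (a ⊙ g) ⊜ a ⊙ ((a ⊙ b) ⊙ g)) refl α β γ) n) (sym (const-* α m n)))) ≋-refl) ≋-refl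
      β*γ*α≈m : β * γ * α ≈ m
      β*γ*α≈m = *-solve 3 (λ a b g → (b ⊙ g) ⊙ a ⊜ (a ⊙ b) ⊙ g) refl α β γ
      α*β*[γ*y₁]≈m*y₁ : α * β * (γ * y₁) ≈ m * y₁
      α*β*[γ*y₁]≈m*y₁ = *-solve 4 (λ a b g y → (a ⊙ b) ⊙ (g ⊙ y) ⊜ ((a ⊙ b) ⊙ g) ⊙ y) refl α β γ y₁

    Δ-⊛-E : Δ α β γ ⊛ E a b c ≋ W m
    Δ-⊛-E = begin
      Δ α β γ ⊛ E a b c                               ≈⟨ ⊛-cong ≋-refl E≋scale-F⊛G ⟩
      Δ α β γ ⊛ (const v ⊛ scale α (F ⊛ G))           ≈⟨ ⊛-solve 3 (λ d c s → d ⊚ (c ⊚ s) ⊜ₛ c ⊚ (d ⊚ s)) ≋-refl (Δ α β γ) (const v) _ ⟩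
      const v ⊛ (Δ α β γ ⊛ scale α (F ⊛ G))           ≈⟨ ⊛-cong ≋-refl Δ-⊛-scale-F⊛G ⟩
      const v ⊛ (const α ⊛ W m)                       ≈⟨ ⊛-assoc (const v) (const α) (W m) ⟨
      const v ⊛ const α ⊛ W m                         ≈⟨ ⊛-cong (λ n → trans (const-* v α n) (const-cong (φ-1/k*ι-k a) n)) ≋-refl ⟩
      const 1# ⊛ W m                                  ≈⟨ ⊛-cong (λ n → *-identityˡ (𝟙 n)) ≋-refl ⟩
      𝟙 ⊛ W m                                         ≈⟨ ⊛-identityˡ (W m) ⟩
      W m                                             ∎
      where open ≋-Reasoning

    Δ-cancelˡ : ∀ {f g} → Δ α β γ ⊛ f ≋ Δ α β γ ⊛ g → f ≋ g
    Δ-cancelˡ {f} {g} Δf≋Δg =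
      expm1-cancelˡ (b ℕ.* c) (sym (ι-* b c))
        (expm1-cancelˡ (a ℕ.* c) (sym (ι-* a c))
          (expm1-cancelˡ (a ℕ.* b) (sym (ι-* a b))
            (λ n → trans (sym (reassoc f n)) (trans (Δf≋Δg n) (reassoc g n)))))
      where
      instance
        _ = ℕP.m*n≢0 a b
        _ = ℕP.m*n≢0 a c
        _ = ℕP.m*n≢0 b c
      reassoc : ∀ h → Δ α β γ ⊛ h ≋ expm1 (α * β) ⊛ (expm1 (α * γ) ⊛ (expm1 (β * γ) ⊛ h))
      reassoc h n = trans (⊛-assoc (expm1 (α * β) ⊛ expm1 (α * γ)) (expm1 (β * γ)) h n)
                          (⊛-assoc (expm1 (α * β)) (expm1 (α * γ)) (expm1 (β * γ) ⊛ h) n)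

  E-unique : ∀ a b c a′ b′ c′ .{{_ : NonZero a}} .{{_ : NonZero b}} .{{_ : NonZero c}}
               .{{_ : NonZero a′}} .{{_ : NonZero b′}} .{{_ : NonZero c′}} →
             Δ (ι a) (ι b) (ι c) ≋ Δ (ι a′) (ι b′) (ι c′) →
             ι a * ι b * ι c ≈ ι a′ * ι b′ * ι c′ →
             E a b c ≋ E a′ b′ c′
  E-unique a b c a′ b′ c′ Δ≋Δ′ m≈m′ = Δ-cancelˡ a b c (λ n → begin
    (Δ (ι a) (ι b) (ι c) ⊛ E a b c) n        ≈⟨ Δ-⊛-E a b c n ⟩
    W (ι a * ι b * ι c) n                    ≈⟨ W-cong m≈m′ n ⟩
    W (ι a′ * ι b′ * ι c′) n                 ≈⟨ Δ-⊛-E a′ b′ c′ n ⟨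
    (Δ (ι a′) (ι b′) (ι c′) ⊛ E a′ b′ c′) n  ≈⟨ ⊛-cong Δ≋Δ′ ≋-refl n ⟨
    (Δ (ι a) (ι b) (ι c) ⊛ E a′ b′ c′) n     ∎)
    where open SetoidReasoning setoid

  E-swap₂₃ : ∀ a b c .{{_ : NonZero a}} .{{_ : NonZero b}} .{{_ : NonZero c}} → E a b c ≋ E a c b
  E-swap₂₃ a b c = E-unique a b c a c b (Δ-comm₂₃ (ι a) (ι b) (ι c))
    (*-solve 3 (λ x y z → (x ⊙ y) ⊙ z ⊜ (x ⊙ z) ⊙ y) refl (ι a) (ι b) (ι c))

  E-swap₁₂ : ∀ a b c .{{_ : NonZero a}} .{{_ : NonZero b}} .{{_ : NonZero c}} → E a b c ≋ E b a c
  E-swap₁₂ a b c = E-unique a b c b a c (Δ-comm₁₂ (ι a) (ι b) (ι c))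
    (*-solve 3 (λ x y z → (x ⊙ y) ⊙ z ⊜ (y ⊙ x) ⊙ z) refl (ι a) (ι b) (ι c))

theorem5 : ∀ {c ℓ} (R : CommutativeRing c ℓ) (φ : ℚ → CommutativeRing.Carrier R) →
    IsℚAlgebraMap R φ →
    (p : ℕ) → Prime p →
    (w₁ w₂ w₃ : ℕ) → .{{_ : NonZero w₁}} → .{{_ : NonZero w₂}} → .{{_ : NonZero w₃}} →
    (y₁ y₂ : CommutativeRing.Carrier R) → (n : ℕ) →
    let _≈_ = CommutativeRing._≈_ R in
    (bigE R φ n w₁ w₂ w₃ y₁ y₂ ≈ bigE R φ n w₁ w₃ w₂ y₁ y₂)
    × (bigE R φ n w₁ w₃ w₂ y₁ y₂ ≈ bigE R φ n w₂ w₁ w₃ y₁ y₂)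
    × (bigE R φ n w₂ w₁ w₃ y₁ y₂ ≈ bigE R φ n w₂ w₃ w₁ y₁ y₂)
    × (bigE R φ n w₂ w₃ w₁ y₁ y₂ ≈ bigE R φ n w₃ w₁ w₂ y₁ y₂)
    × (bigE R φ n w₃ w₁ w₂ y₁ y₂ ≈ bigE R φ n w₃ w₂ w₁ y₁ y₂)
theorem5 R φ hom _ _ w₁ w₂ w₃ y₁ y₂ n =
    E-swap₂₃ w₁ w₂ w₃ n
  , trans (sym (E-swap₂₃ w₁ w₂ w₃ n)) (E-swap₁₂ w₁ w₂ w₃ n)
  , E-swap₂₃ w₂ w₁ w₃ n
  , trans (E-swap₁₂ w₂ w₃ w₁ n) (E-swap₂₃ w₃ w₂ w₁ n)
  , E-swap₂₃ w₃ w₁ w₂ n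
  where
  open CommutativeRing R using (trans; sym)
  open TripleSymmetry R φ hom y₁ y₂ using (E-swap₁₂; E-swap₂₃)
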